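{- The $k$-FVS problem on $n$-vertex graphs can be solved by a deterministic one-pass streaming algorithm using $O(k\cdot n)$ space in insertion-only streams and $\widetilde{O}(k\cdot n)$ space in insertion-deletion streams.
   Context: $k$-FVS: given an undirected graph $G=(V,E)$, decide whether there is a set $X\subseteq V$ with $|X|\le k$ such that $G\setminus X$ has no cycles. Streaming model: the $n$ vertices are fixed, edges arrive one by one (insertion-only: only insertions; insertion-deletion: insertions and deletions). Space is measured in words of $O(\log n)$ bits; $\widetilde{O}$ hides $\log^{O(1)} n$ factors; unbounded computation is allowed. -}

module Defs where

open import Data.Nat using (ℕ; suc; _+_; _*_; _^_; _≤_; _⊔_)
open import Data.Nat.Logarithm using (⌈log₂_⌉)
open import Data.Bool using (Bool; true; false; not; if_then_else_; _∧_; _∨_)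
open import Data.Fin using (Fin; _≟_)
open import Data.Fin.Subset using (Subset; _∉_; ∣_∣)
open import Data.List using (List; []; _∷_; _++_; [_]; length; foldl)
open import Data.List.Relation.Unary.All using (All)
open import Data.List.Relation.Unary.Unique.Propositional using (Unique)
open import Data.List.Relation.Unary.Linked using (Linked)
open import Data.Vec using (Vec)
open import Data.Product using (Σ; ∃; _×_; _,_)
open import Data.Unit using (⊤)
open import Relation.Binary.PropositionalEquality using (_≡_; _≢_)
open import Relation.Nullary.Decidable using (⌊_⌋)
open import Function.Bundles using (_⇔_)

-- Graphs on the vertex set Fin n, given by a (symmetric) Boolean
-- adjacency function.

Graph : ℕ → Set
Graph n = Fin n → Fin n → Bool

Adj : ∀ {n} → Graph n → Fin n → Fin n → Set
Adj G u v = G u v ≡ true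

emptyGraph : ∀ {n} → Graph n
emptyGraph _ _ = false

-- A cycle of G avoiding X: distinct vertices v ∷ rest (at least 3),
-- consecutive ones adjacent, and the last adjacent to the first v.
record CycleAvoiding {n} (G : Graph n) (X : Subset n) : Set where
  field
    v        : Fin n
    rest     : List (Fin n)
    long     : 2 ≤ length rest
    distinct : Unique (v ∷ rest)
    avoid    : All (_∉ X) (v ∷ rest)
    closed   : Linked (Adj G) (v ∷ rest ++ [ v ])

Acyclic∖ : ∀ {n} → Graph n → Subset n → Set
Acyclic∖ G X = CycleAvoiding G X → Data.Empty.⊥
  where import Data.Empty

HasFVS : ∀ {n} → ℕ → Graph n → Set
HasFVS {n} k G = Σ (Subset n) λ X → ∣ X ∣ ≤ k × Acyclic∖ G X

-- Streams. An update is (b , u , v): b = true means insertion of the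
-- edge {u,v}, b = false means its deletion. Streams are lists in order
-- of arrival.

Update : ℕ → Set
Update n = Bool × Fin n × Fin n

applyUpd : ∀ {n} → Graph n → Update n → Graph n
applyUpd G (b , u , v) x y =
  if (⌊ x ≟ u ⌋ ∧ ⌊ y ≟ v ⌋) ∨ (⌊ x ≟ v ⌋ ∧ ⌊ y ≟ u ⌋) then b else G x y

graphAfter : ∀ {n} → Graph n → List (Update n) → Graph n
graphAfter G s = foldl applyUpd G s

graphOf : ∀ {n} → List (Update n) → Graph n
graphOf s = graphAfter emptyGraph s

-- A valid (simple-graph) stream: no loops, insertions only of absent
-- edges, deletions only of present edges.
ValidFrom : ∀ {n} → Graph n → List (Update n) → Set
ValidFrom G [] = ⊤
ValidFrom G ((b , u , v) ∷ s) =
  u ≢ v × G u v ≡ not b × ValidFrom (applyUpd G (b , u , v)) s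

ValidStream : ∀ {n} → List (Update n) → Set
ValidStream s = ValidFrom emptyGraph s

InsertionOnly : ∀ {n} → List (Update n) → Set
InsertionOnly s = All (λ upd → Data.Product.proj₁ upd ≡ true) s
  where import Data.Product

-- Deterministic one-pass streaming algorithm whose memory is s bits.

record StreamAlg (U : Set) (s : ℕ) : Set where
  field
    init : Vec Bool s
    step : Vec Bool s → U → Vec Bool s
    out  : Vec Bool s → Bool

runAlg : ∀ {U s} → StreamAlg U s → List U → Bool
runAlg A str = StreamAlg.out A (foldl (StreamAlg.step A) (StreamAlg.init A) str)

Solves : ∀ {n s} → (List (Update n) → Set) → ℕ → StreamAlg (Update n) s → Set
Solves {n} P k A = ∀ (str : List (Update n)) → ValidStream str → P str →
  (runAlg A str ≡ true) ⇔ HasFVS k (graphOf str)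

-- bits in one word of O(log n) bits
wordBits : ℕ → ℕ
wordBits n = suc ⌈log₂ n ⌉

-- k·n words, with k replaced by max(k,1) so the bound is nontrivial at k = 0
kn : ℕ → ℕ → ℕ
kn k n = (k ⊔ 1) * n

AnyStream : ∀ {n} → List (Update n) → Set
AnyStream _ = ⊤

module Submission where

-- The state is a linear sketch of the adjacency vector f : Fin (n·n) → Bool of
-- the current graph: a binary counter holding the number of ones of f, and
-- the syndrome ⨁_{f i} code i ∈ GF(2)^t of f under a code in which no
-- nonempty set of at most 2B codewords sums to zero.  An edge insertion or
-- deletion toggles two coordinates of f, so both parts update exactly.
-- A graph with a feedback vertex set of size ≤ k has degree sum at most
-- B = 2n + 2nk (the edges avoiding the FVS form a forest, whose degree sum is
-- at most twice its number of non-isolated vertices), and two vectors with at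
-- most B ones and equal syndromes coincide.  So the output "some vector with
-- the stored count ≤ B and the stored syndrome is a yes-instance", decided by
-- exhaustive search, is correct.  A greedy (Gilbert–Varshamov) code needs
-- only t = 1 + 2w·2B bits, giving the space bound.

open import Defs
open import Level using (0ℓ)
open import Data.Nat using (ℕ; zero; suc; _+_; _*_; _∸_; _^_; _≤_; _<_; _≤?_; _<?_; _⊔_; z≤n; s≤s; s≤s⁻¹; ⌊_/2⌋; ⌈_/2⌉)
open import Data.Nat.Properties renaming (_≟_ to _≟ℕ_)
open import Data.Nat.Logarithm using (⌈log₂_⌉; ⌈log₂⌉-mono-≤; ⌈log₂2^n⌉≡n; ⌈log₂⌈n/2⌉⌉≡⌈log₂n⌉∸1)
open import Data.Nat.Tactic.RingSolver using (solve-∀)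
open import Data.Fin using (Fin; zero; suc; _≟_; _↑ˡ_; _↑ʳ_; combine; remQuot) renaming (_<_ to _<ᶠ_)
import Data.Fin.Properties as Finₚ
open import Data.Fin.Subset using (Subset; ⊥; _∉_; ∣_∣)
open import Data.Fin.Subset.Properties using (∪-∩-booleanAlgebra; anySubset?) renaming (_∈?_ to _∈ˢ?_)
open import Data.Bool using (Bool; true; false; not; _∧_; _∨_; _xor_; if_then_else_)
open import Data.Bool.Properties using (xor-comm; xor-identityʳ; ∧-comm; ∨-comm; ∨-zeroʳ; not-involutive) renaming (_≟_ to _≟ᵇ_)
open import Data.Vec using (Vec; []; _∷_; take; drop; splitAt; tabulate) renaming (lookup to lookupᵛ; _++_ to _++ᵛ_)
open import Data.Vec.Properties using ([]=⇒lookup; lookup∘tabulate; ≡-dec; ++-injectiveˡ; ++-injectiveʳ)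
open import Data.Vec.Functional using () renaming (_∷_ to _◂_)
open import Data.List using (List; []; _∷_; _++_; [_]; map; length; foldl) renaming (lookup to lookupˡ)
open import Data.List.Properties using (++-assoc; length-map; length-++)
open import Data.List.Membership.Propositional using () renaming (_∈_ to _∈ₗ_; _∉_ to _∉ₗ_)
open import Data.List.Membership.Propositional.Properties using (∈-map⁺; ∈-++⁺ˡ; ∈-++⁺ʳ; ∈-∃++)
import Data.List.Membership.DecPropositional as DecMembership
open import Data.List.Relation.Unary.Any using (here; there)
open import Data.List.Relation.Unary.All using (All; []; _∷_; all?)
open import Data.List.Relation.Unary.All.Properties using (++⁻ˡ; ¬Any⇒All¬)
open import Data.List.Relation.Unary.AllPairs using ([]; _∷_; allPairs?)
open import Data.List.Relation.Unary.Unique.Propositional using (Unique)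
open import Data.List.Relation.Unary.Linked using (Linked; []; [-]; _∷_; linked?) renaming (map to linked-map)
open import Data.Product using (Σ; _×_; _,_; proj₁; proj₂)
open import Data.Empty using (⊥-elim)
open import Data.Unit using (tt)
open import Function using (_∘_)
open import Function.Bundles using (_⇔_; mk⇔; Equivalence)
open import Relation.Nullary using (¬_; Dec; yes; no; ¬?)
open import Relation.Nullary.Decidable using (⌊_⌋; isYes≗does; dec-true; dec-false; ⌊⌋-map′; _×-dec_; map′)
open import Relation.Binary.PropositionalEquality hiding ([_])
open import Algebra.Bundles using (AbelianGroup)
import Algebra.Lattice.Properties.BooleanAlgebra as BooleanAlgebraProperties
import Algebra.Properties.CommutativeMonoid.Sum as MonoidSum
import Algebra.Properties.Group as GroupProperties
open MonoidSum +-0-commutativeMonoid using (sum; sum-cong-≗; ∑-distrib-+)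

sum-mono : ∀ {N} {f g : Fin N → ℕ} → (∀ i → f i ≤ g i) → sum f ≤ sum g
sum-mono {zero}  _   = z≤n
sum-mono {suc N} f≤g = +-mono-≤ (f≤g zero) (sum-mono (f≤g ∘ suc))

sum-mono-< : ∀ {N} {f g : Fin N → ℕ} (p : Fin N) → (∀ i → f i ≤ g i) → f p < g p → sum f < sum g
sum-mono-< {suc N} zero    f≤g fp<gp = +-mono-<-≤ fp<gp (sum-mono (f≤g ∘ suc))
sum-mono-< {suc N} (suc p) f≤g fp<gp = +-mono-≤-< (f≤g zero) (sum-mono-< p (f≤g ∘ suc) fp<gp)

sum-const : ∀ N c → sum {N} (λ _ → c) ≡ N * c
sum-const zero    c = refl
sum-const (suc N) c = cong (c +_) (sum-const N c)

sum-*ˡ : ∀ {N} c (f : Fin N → ℕ) → sum (λ i → c * f i) ≡ c * sum f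
sum-*ˡ {zero}  c f = sym (*-zeroʳ c)
sum-*ˡ {suc N} c f = trans (cong (c * f zero +_) (sum-*ˡ c (f ∘ suc))) (sym (*-distribˡ-+ c (f zero) _))

sum-positive : ∀ {N} (f : Fin N → ℕ) → 0 < sum f → Σ (Fin N) λ i → 0 < f i
sum-positive {suc N} f pos with f zero in eq
... | suc _ = zero , subst (0 <_) (sym eq) (s≤s z≤n)
... | zero  = let (i , fi>0) = sum-positive (f ∘ suc) pos in suc i , fi>0

sum-update : ∀ {N} (f g : Fin N → ℕ) (p : Fin N) → (∀ i → i ≢ p → f i ≡ g i) →
             sum f + g p ≡ sum g + f p
sum-update {suc N} f g zero f≗g
  rewrite sum-cong-≗ {x = f ∘ suc} {y = g ∘ suc} (λ i → f≗g (suc i) λ ()) =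
  trans (+-assoc (f zero) _ _) (trans (+-comm (f zero) _) (cong (_+ f zero) (+-comm _ (g zero))))
sum-update {suc N} f g (suc p) f≗g = begin
  f zero + sum (f ∘ suc) + g (suc p)   ≡⟨ +-assoc (f zero) _ _ ⟩
  f zero + (sum (f ∘ suc) + g (suc p)) ≡⟨ cong₂ _+_ (f≗g zero λ ()) (sum-update (f ∘ suc) (g ∘ suc) p off) ⟩
  g zero + (sum (g ∘ suc) + f (suc p)) ≡⟨ +-assoc (g zero) _ _ ⟨
  g zero + sum (g ∘ suc) + f (suc p)   ∎
  where
  open ≡-Reasoning
  off : ∀ i → i ≢ p → f (suc i) ≡ g (suc i)
  off i i≢p = f≗g (suc i) (i≢p ∘ Finₚ.suc-injective)

bit : Bool → ℕ
bit true  = 1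
bit false = 0

cnt : ∀ {N} → (Fin N → Bool) → ℕ
cnt f = sum (bit ∘ f)

bit≤1 : ∀ b → bit b ≤ 1
bit≤1 true  = s≤s z≤n
bit≤1 false = z≤n

cnt-mono : ∀ {N} {f g : Fin N → Bool} → (∀ i → f i ≡ true → g i ≡ true) → cnt f ≤ cnt g
cnt-mono {f = f} {g} f⊆g = sum-mono pointwise
  where
  pointwise : ∀ i → bit (f i) ≤ bit (g i)
  pointwise i with f i | f⊆g i
  ... | true  | fi⇒gi rewrite fi⇒gi refl = ≤-refl
  ... | false | _ = z≤n

cnt≤N : ∀ {N} (f : Fin N → Bool) → cnt f ≤ N
cnt≤N {N} f = begin
  cnt f                  ≤⟨ sum-mono (bit≤1 ∘ f) ⟩
  sum {N} (λ _ → 1)      ≡⟨ sum-const N 1 ⟩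
  N * 1                  ≡⟨ *-identityʳ N ⟩
  N                      ∎
  where open ≤-Reasoning

cnt-lookup : ∀ {N} (X : Subset N) → cnt (lookupᵛ X) ≡ ∣ X ∣
cnt-lookup []          = refl
cnt-lookup (true ∷ X)  = cong suc (cnt-lookup X)
cnt-lookup (false ∷ X) = cnt-lookup X

cnt-positive : ∀ {N} (f : Fin N → Bool) → 0 < cnt f → Σ (Fin N) λ i → f i ≡ true
cnt-positive f pos with sum-positive (bit ∘ f) pos
... | i , fi>0 = i , bit-positive fi>0
  where
  bit-positive : ∀ {b} → 0 < bit b → b ≡ true
  bit-positive {true} _ = refl

single : ∀ {N} → Fin N → Fin N → Bool
single p i = ⌊ i ≟ p ⌋

toggle : ∀ {N} → Fin N → (Fin N → Bool) → Fin N → Bool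
toggle p f i = f i xor single p i

single-self : ∀ {N} (p : Fin N) → single p p ≡ true
single-self p = trans (isYes≗does (p ≟ p)) (dec-true (p ≟ p) refl)

single-other : ∀ {N} {p i : Fin N} → i ≢ p → single p i ≡ false
single-other {p = p} {i} i≢p = trans (isYes≗does (i ≟ p)) (dec-false (i ≟ p) i≢p)

toggle-self : ∀ {N} (p : Fin N) f → toggle p f p ≡ not (f p)
toggle-self p f rewrite single-self p = xor-comm (f p) true

toggle-other : ∀ {N} {p i : Fin N} f → i ≢ p → toggle p f i ≡ f i
toggle-other {p = p} {i} f i≢p rewrite single-other i≢p = xor-identityʳ (f i)

cnt-toggle : ∀ {N} (p : Fin N) f → cnt (toggle p f) + bit (f p) ≡ cnt f + bit (not (f p))
cnt-toggle p f = begin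
  cnt (toggle p f) + bit (f p)            ≡⟨ sum-update (bit ∘ toggle p f) (bit ∘ f) p agree ⟩
  cnt f + bit (toggle p f p)              ≡⟨ cong (λ b → cnt f + bit b) (toggle-self p f) ⟩
  cnt f + bit (not (f p))                 ∎
  where
  open ≡-Reasoning
  agree : ∀ i → i ≢ p → bit (toggle p f i) ≡ bit (f i)
  agree i i≢p = cong bit (toggle-other f i≢p)

true≢false : true ≢ false
true≢false ()

cnt-drop : ∀ {N} (f : Fin N → Bool) {p} → f p ≡ true → cnt (toggle p f) + 1 ≡ cnt f
cnt-drop f {p} fp = begin
  cnt (toggle p f) + 1          ≡⟨ cong (λ b → cnt (toggle p f) + bit b) fp ⟨
  cnt (toggle p f) + bit (f p)  ≡⟨ cnt-toggle p f ⟩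
  cnt f + bit (not (f p))       ≡⟨ cong (λ b → cnt f + bit (not b)) fp ⟩
  cnt f + 0                     ≡⟨ +-identityʳ (cnt f) ⟩
  cnt f                         ∎
  where open ≡-Reasoning

cnt-raise : ∀ {N} (f : Fin N → Bool) {p} → f p ≡ false → cnt (toggle p f) ≡ cnt f + 1
cnt-raise f {p} fp = begin
  cnt (toggle p f)              ≡⟨ +-identityʳ _ ⟨
  cnt (toggle p f) + 0          ≡⟨ cong (λ b → cnt (toggle p f) + bit b) fp ⟨
  cnt (toggle p f) + bit (f p)  ≡⟨ cnt-toggle p f ⟩
  cnt f + bit (not (f p))       ≡⟨ cong (λ b → cnt f + bit (not b)) fp ⟩
  cnt f + 1                     ∎
  where open ≡-Reasoning

cnt-witness : ∀ {N} (f : Fin N → Bool) {p} → f p ≡ true → 0 < cnt f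
cnt-witness f {p} fp = subst (1 ≤_) (cnt-drop f fp) (m≤n+m 1 (cnt (toggle p f)))

cnt-other : ∀ {N} (f : Fin N → Bool) → 1 < cnt f → (p : Fin N) → Σ (Fin N) λ w → w ≢ p × f w ≡ true
cnt-other f 1<cnt p with f p in fp
... | false = let (w , fw) = cnt-positive f (<-trans (s≤s z≤n) 1<cnt) in
  w , (λ w≡p → true≢false (trans (sym fw) (trans (cong f w≡p) fp))) , fw
... | true  = let (w , tw) = cnt-positive f′ 0<cnt in
  w , w≢p tw , trans (sym (toggle-other f (w≢p tw))) tw
  where
  f′ : _ → Bool
  f′ = toggle p f
  0<cnt : 0 < cnt f′
  0<cnt = s≤s⁻¹ (subst (1 <_) (trans (sym (cnt-drop f fp)) (+-comm (cnt f′) 1)) 1<cnt)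
  w≢p : ∀ {w} → f′ w ≡ true → w ≢ p
  w≢p tw refl = true≢false (trans (sym tw) (trans (toggle-self p f) (cong not fp)))

tailsWith : ∀ {t} → Bool → List (Vec Bool (suc t)) → List (Vec Bool t)
tailsWith b [] = []
tailsWith true  ((true  ∷ v) ∷ L) = v ∷ tailsWith true L
tailsWith true  ((false ∷ v) ∷ L) = tailsWith true L
tailsWith false ((true  ∷ v) ∷ L) = tailsWith false L
tailsWith false ((false ∷ v) ∷ L) = v ∷ tailsWith false L

tailsWith-length : ∀ {t} (L : List (Vec Bool (suc t))) →
                   length (tailsWith false L) + length (tailsWith true L) ≡ length L
tailsWith-length [] = refl
tailsWith-length ((true  ∷ v) ∷ L) = trans (+-suc _ _) (cong suc (tailsWith-length L))
tailsWith-length ((false ∷ v) ∷ L) = cong suc (tailsWith-length L)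

tailsWith-∈ : ∀ {t} b {c : Vec Bool t} (L : List (Vec Bool (suc t))) → (b ∷ c) ∈ₗ L → c ∈ₗ tailsWith b L
tailsWith-∈ true  ((true  ∷ v) ∷ L) (here refl) = here refl
tailsWith-∈ false ((false ∷ v) ∷ L) (here refl) = here refl
tailsWith-∈ true  ((true  ∷ v) ∷ L) (there c∈L) = there (tailsWith-∈ true L c∈L)
tailsWith-∈ true  ((false ∷ v) ∷ L) (there c∈L) = tailsWith-∈ true L c∈L
tailsWith-∈ false ((true  ∷ v) ∷ L) (there c∈L) = tailsWith-∈ false L c∈L
tailsWith-∈ false ((false ∷ v) ∷ L) (there c∈L) = there (tailsWith-∈ false L c∈L)

fresh : ∀ t (L : List (Vec Bool t)) → length L < 2 ^ t → Σ (Vec Bool t) λ c → c ∉ₗ L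
fresh zero    []      _ = [] , λ ()
fresh zero    (_ ∷ _) (s≤s ())
fresh (suc t) L short with length (tailsWith false L) <? 2 ^ t
... | yes few = let (c , c∉) = fresh t (tailsWith false L) few in
                false ∷ c , c∉ ∘ tailsWith-∈ false L
... | no many = let (c , c∉) = fresh t (tailsWith true L) few in
                true ∷ c , c∉ ∘ tailsWith-∈ true L
  where
  few : length (tailsWith true L) < 2 ^ t
  few = +-cancelˡ-< (length (tailsWith false L)) _ _ (begin-strict
    length (tailsWith false L) + length (tailsWith true L)  ≡⟨ tailsWith-length L ⟩
    length L                                                <⟨ short ⟩
    2 ^ t + (2 ^ t + 0)                                     ≡⟨ cong (2 ^ t +_) (+-identityʳ (2 ^ t)) ⟩
    2 ^ t + 2 ^ t                                           ≤⟨ +-monoˡ-≤ (2 ^ t) (≮⇒≥ many) ⟩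
    length (tailsWith false L) + 2 ^ t                      ∎)
    where open ≤-Reasoning

sparseVectors : ∀ N → ℕ → List (Fin N → Bool)
sparseVectors zero    d       = [ (λ ()) ]
sparseVectors (suc N) zero    = [ (λ _ → false) ]
sparseVectors (suc N) (suc d) = map (false ◂_) (sparseVectors N (suc d)) ++ map (true ◂_) (sparseVectors N d)

sparseVectors-length : ∀ N d → length (sparseVectors N d) ≤ suc N ^ d
sparseVectors-length zero    d    = ≤-reflexive (sym (^-zeroˡ d))
sparseVectors-length (suc N) zero = ≤-refl
sparseVectors-length (suc N) (suc d) = begin
  length (map (false ◂_) (sparseVectors N (suc d)) ++ map (true ◂_) (sparseVectors N d))
    ≡⟨ length-++ (map (false ◂_) (sparseVectors N (suc d))) ⟩
  length (map (false ◂_) (sparseVectors N (suc d))) + length (map (true ◂_) (sparseVectors N d))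
    ≡⟨ cong₂ _+_ (length-map (false ◂_) (sparseVectors N (suc d))) (length-map (true ◂_) (sparseVectors N d)) ⟩
  length (sparseVectors N (suc d)) + length (sparseVectors N d)
    ≤⟨ +-mono-≤ (sparseVectors-length N (suc d)) (sparseVectors-length N d) ⟩
  suc N ^ suc d + suc N ^ d
    ≡⟨ +-comm (suc N * suc N ^ d) (suc N ^ d) ⟩
  suc (suc N) * suc N ^ d
    ≤⟨ *-monoʳ-≤ (suc (suc N)) (^-monoˡ-≤ d (n≤1+n (suc N))) ⟩
  suc (suc N) ^ suc d ∎
  where open ≤-Reasoning

sparseVectors-complete : ∀ N d (D : Fin N → Bool) → cnt D ≤ d →
                         Σ (Fin N → Bool) λ D′ → D′ ∈ₗ sparseVectors N d × (∀ i → D i ≡ D′ i)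
sparseVectors-complete zero    d    D _ = (λ ()) , here refl , λ ()
sparseVectors-complete (suc N) zero D none = (λ _ → false) , here refl , all-false
  where
  all-false : ∀ i → D i ≡ false
  all-false i with D i in Di
  ... | false = refl
  ... | true  = ⊥-elim (<⇒≱ (cnt-witness D Di) none)
sparseVectors-complete (suc N) (suc d) D few with D zero in D0
... | false = let (D′ , D′∈ , D≗D′) = sparseVectors-complete N (suc d) (D ∘ suc) few in
  false ◂ D′ , ∈-++⁺ˡ (∈-map⁺ (false ◂_) D′∈) , λ { zero → D0 ; (suc i) → D≗D′ i }
... | true  = let (D′ , D′∈ , D≗D′) = sparseVectors-complete N d (D ∘ suc) (s≤s⁻¹ few) in
  true ◂ D′ , ∈-++⁺ʳ (map (false ◂_) (sparseVectors N (suc d))) (∈-map⁺ (true ◂_) D′∈) ,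
  λ { zero → D0 ; (suc i) → D≗D′ i }

module _ {t : ℕ} where

  -- Subset t under symmetric difference ⊕ is the group GF(2)^t; ⨁ sums in it.
  open BooleanAlgebraProperties (∪-∩-booleanAlgebra t) public using (_⊕_)
  open BooleanAlgebraProperties.DefaultXorRing (∪-∩-booleanAlgebra t) using (⊕-⊥-isAbelianGroup)

  ⊕-abelianGroup : AbelianGroup 0ℓ 0ℓ
  ⊕-abelianGroup = record { isAbelianGroup = ⊕-⊥-isAbelianGroup }

  open AbelianGroup ⊕-abelianGroup using (identityˡ; identityʳ; inverseʳ; group; commutativeMonoid)
  open MonoidSum commutativeMonoid using ()
    renaming (sum to ⨁; sum-cong-≗ to ⨁-cong; ∑-distrib-+ to ⨁-distrib; sum-replicate-zero to ⨁-zero)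

  -- Every element is its own inverse, so a ⊕ b = ⊥ forces a = b.
  ⊕≡⊥⇒≡ : ∀ (a b : Subset t) → a ⊕ b ≡ ⊥ → a ≡ b
  ⊕≡⊥⇒≡ = GroupProperties.x∙y⁻¹≈ε⇒x≈y group

  scale : Bool → Subset t → Subset t
  scale true  c = c
  scale false c = ⊥

  scale-xor : ∀ a b c → scale (a xor b) c ≡ scale a c ⊕ scale b c
  scale-xor true  true  c = sym (inverseʳ c)
  scale-xor true  false c = sym (identityʳ c)
  scale-xor false b     c = sym (identityˡ (scale b c))

  syn : ∀ {N} → (Fin N → Subset t) → (Fin N → Bool) → Subset t
  syn code D = ⨁ (λ i → scale (D i) (code i))

  syn-cong : ∀ {N} (code : Fin N → Subset t) {D D′ : Fin N → Bool} → (∀ i → D i ≡ D′ i) → syn code D ≡ syn code D′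
  syn-cong code D≗D′ = ⨁-cong (λ i → cong (λ b → scale b (code i)) (D≗D′ i))

  syn-xor : ∀ {N} (code : Fin N → Subset t) D D′ → syn code (λ i → D i xor D′ i) ≡ syn code D ⊕ syn code D′
  syn-xor code D D′ = trans (⨁-cong (λ i → scale-xor (D i) (D′ i) (code i)))
                            (⨁-distrib (λ i → scale (D i) (code i)) (λ i → scale (D′ i) (code i)))

  syn-single : ∀ {N} (code : Fin N → Subset t) p → syn code (single p) ≡ code p
  syn-single {suc N} code zero = trans (cong (code zero ⊕_) (⨁-zero N)) (identityʳ (code zero))
  syn-single {suc N} code (suc p) = begin
    ⊥ ⊕ ⨁ (λ i → scale (single (suc p) (suc i)) (code (suc i)))  ≡⟨ identityˡ _ ⟩
    ⨁ (λ i → scale (single (suc p) (suc i)) (code (suc i)))      ≡⟨ syn-cong (code ∘ suc) (λ i → ⌊⌋-map′ _ _ (i ≟ p)) ⟩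
    syn (code ∘ suc) (single p)                          ≡⟨ syn-single (code ∘ suc) p ⟩
    code (suc p)                                         ∎
    where open ≡-Reasoning

  syn-toggle : ∀ {N} (code : Fin N → Subset t) p f → syn code (toggle p f) ≡ syn code f ⊕ code p
  syn-toggle code p f = trans (syn-xor code f (single p)) (cong (syn code f ⊕_) (syn-single code p))

  Independent : ∀ {N} → ℕ → (Fin N → Subset t) → Set
  Independent d code = ∀ D → cnt D ≤ d → syn code D ≡ ⊥ → ∀ i → D i ≡ false

  syn-injective : ∀ {N a b} {code : Fin N → Subset t} → Independent (a + b) code →
                  ∀ S S′ → cnt S ≤ a → cnt S′ ≤ b → syn code S ≡ syn code S′ → ∀ i → S i ≡ S′ i
  syn-injective {N} {a} {b} {code} independent S S′ cntS cntS′ same i =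
    xor-false (independent D cntD synD i)
    where
    D : Fin N → Bool
    D j = S j xor S′ j
    bit-xor : ∀ x y → bit (x xor y) ≤ bit x + bit y
    bit-xor true  true  = z≤n
    bit-xor true  false = ≤-refl
    bit-xor false y     = ≤-refl
    xor-false : ∀ {x y} → x xor y ≡ false → x ≡ y
    xor-false {true}  {true}  _ = refl
    xor-false {false} {false} _ = refl
    cntD : cnt D ≤ a + b
    cntD = begin
      cnt D                  ≤⟨ sum-mono (λ j → bit-xor (S j) (S′ j)) ⟩
      sum (λ j → bit (S j) + bit (S′ j))  ≡⟨ ∑-distrib-+ (bit ∘ S) (bit ∘ S′) ⟩
      cnt S + cnt S′         ≤⟨ +-mono-≤ cntS cntS′ ⟩
      a + b                  ∎
      where open ≤-Reasoning
    synD : syn code D ≡ ⊥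
    synD = trans (syn-xor code S S′) (trans (cong (syn code S ⊕_) (sym same)) (inverseʳ (syn code S)))

  -- Greedy construction (Gilbert–Varshamov): a new codeword must avoid the
  -- at most N^d syndromes of sparse sets of the previous codewords.
  independent-code : ∀ d N → N ^ d < 2 ^ t → Σ (Fin N → Subset t) (Independent d)
  independent-code d zero    _     = (λ ()) , λ _ _ _ ()
  independent-code d (suc N) small = c ◂ code , independent
    where
    previous : Σ (Fin N → Subset t) (Independent d)
    previous = independent-code d N (≤-<-trans (^-monoˡ-≤ d (n≤1+n N)) small)
    code : Fin N → Subset t
    code = proj₁ previous
    avoid : List (Subset t)
    avoid = map (syn code) (sparseVectors N d)
    few : length avoid < 2 ^ t
    few = begin-strict
      length avoid                     ≡⟨ length-map (syn code) (sparseVectors N d) ⟩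
      length (sparseVectors N d)       ≤⟨ sparseVectors-length N d ⟩
      suc N ^ d                        <⟨ small ⟩
      2 ^ t                            ∎
      where open ≤-Reasoning
    c : Subset t
    c = proj₁ (fresh t avoid few)
    c∉ : c ∉ₗ avoid
    c∉ = proj₂ (fresh t avoid few)
    independent : Independent d (c ◂ code)
    independent D sparse zero-syn with D zero in D0
    ... | false = λ { zero → D0 ; (suc i) → proj₂ previous (D ∘ suc) sparse (trans (sym (identityˡ _)) zero-syn) i }
    ... | true  with sparseVectors-complete N d (D ∘ suc) (≤-trans (n≤1+n _) sparse)
    ...   | D′ , D′∈ , D≗D′ = ⊥-elim (c∉ (subst (_∈ₗ avoid) c≡ (∈-map⁺ (syn code) D′∈)))
      where
      -- c ⊕ syn (D ∘ suc) = ⊥ makes c the syndrome of a sparse vector.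
      c≡ : syn code D′ ≡ c
      c≡ = trans (sym (syn-cong code D≗D′)) (sym (⊕≡⊥⇒≡ c _ zero-syn))

unique-length : ∀ {n} {xs : List (Fin n)} → Unique xs → length xs ≤ n
unique-length {n} {xs} unique with n <? length xs
... | no  short = ≮⇒≥ short
... | yes long  = let (i , j , i<j , same) = Finₚ.pigeonhole long (lookupˡ xs) in
                  ⊥-elim (distinct unique i j i<j same)
  where
  distinct : ∀ {xs : List (Fin n)} → Unique xs → ∀ i j → i <ᶠ j → lookupˡ xs i ≢ lookupˡ xs j
  distinct (x∉ ∷ _) zero    (suc j) _   = lookupAll x∉ j
    where
    lookupAll : ∀ {x} {ys : List (Fin n)} → All (x ≢_) ys → ∀ j → x ≢ lookupˡ ys j
    lookupAll (x≢ ∷ _)   zero    = x≢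
    lookupAll (_  ∷ x≢s) (suc j) = lookupAll x≢s j
  distinct (_  ∷ unique) (suc i) (suc j) i<j = distinct unique i j (s≤s⁻¹ i<j)

unique-prefix : ∀ {A : Set} (xs : List A) {ys} → Unique (xs ++ ys) → Unique xs
unique-prefix []       _             = []
unique-prefix (x ∷ xs) (x∉ ∷ unique) = ++⁻ˡ xs x∉ ∷ unique-prefix xs unique

linked-prefix : ∀ {A : Set} {R : A → A → Set} (xs : List A) {ys} → Linked R (xs ++ ys) → Linked R xs
linked-prefix []           _            = []
linked-prefix (x ∷ [])     _            = [-]
linked-prefix (x ∷ y ∷ xs) (r ∷ linked) = r ∷ linked-prefix (y ∷ xs) linked

linked-snoc : ∀ {A : Set} {R : A → A → Set} (xs : List A) {z y} → Linked R (xs ++ [ z ]) → R z y →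
              Linked R ((xs ++ [ z ]) ++ [ y ])
linked-snoc []           _            r = r ∷ [-]
linked-snoc (x ∷ [])     (r′ ∷ _)     r = r′ ∷ r ∷ [-]
linked-snoc (x ∷ x′ ∷ xs) (r′ ∷ linked) r = r′ ∷ linked-snoc (x′ ∷ xs) linked r

Symmetric : ∀ {n} → Graph n → Set
Symmetric {n} H = ∀ (x y : Fin n) → H x y ≡ H y x

Loopless : ∀ {n} → Graph n → Set
Loopless {n} H = ∀ (x : Fin n) → H x x ≡ false

EdgesAvoid : ∀ {n} → Subset n → Graph n → Set
EdgesAvoid {n} Y H = ∀ (x y : Fin n) → H x y ≡ true → x ∉ Y

_⊆ᴳ_ : ∀ {n} → Graph n → Graph n → Set
_⊆ᴳ_ {n} H G = ∀ (x y : Fin n) → H x y ≡ true → G x y ≡ true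

deg : ∀ {n} → Graph n → Fin n → ℕ
deg H x = cnt (H x)

degSum : ∀ {n} → Graph n → ℕ
degSum H = sum (deg H)

positive : ℕ → Bool
positive zero    = false
positive (suc _) = true

nonIsolated : ∀ {n} → Graph n → ℕ
nonIsolated H = cnt (λ x → positive (deg H x))

acyclic-⊆ : ∀ {n} {G H : Graph n} {Y} → H ⊆ᴳ G → Acyclic∖ G Y → Acyclic∖ H Y
acyclic-⊆ H⊆G acyclic cycle = acyclic record
  { v = v ; rest = rest ; long = long ; distinct = distinct ; avoid = avoid
  ; closed = linked-map (λ {x} {y} → H⊆G x y) closed }
  where open CycleAvoiding cycle

-- In a forest H (relative to Y, with all edges avoiding Y) every edge leads to a
-- leaf: extend a simple path at its end v until v has degree one; a neighbour
-- of v already on the path would close a cycle.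
module _ {n} {H : Graph n} {Y : Subset n} (symmetric : Symmetric H) (loopless : Loopless H)
         (avoids : EdgesAvoid Y H) (acyclic : Acyclic∖ H Y) where

  open DecMembership (_≟_ {n}) using () renaming (_∈?_ to _∈ₗ?_)

  close-cycle : ∀ {v u w rest} → Unique (v ∷ u ∷ rest) → Linked (Adj H) (v ∷ u ∷ rest) →
                All (_∉ Y) (v ∷ u ∷ rest) → H w v ≡ true → w ∈ₗ rest → CycleAvoiding H Y
  close-cycle {v} {u} {w} {rest} unique linked avoid wv w∈rest with ∈-∃++ w∈rest
  ... | pre , post , rest≡ = record
    { v        = v
    ; rest     = u ∷ pre ++ [ w ]
    ; long     = subst (2 ≤_) (cong suc (sym (length-++ pre))) (s≤s (m≤n+m 1 (length pre)))
    ; distinct = unique-prefix cycle (subst Unique split unique)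
    ; avoid    = ++⁻ˡ cycle (subst (All (_∉ Y)) split avoid)
    ; closed   = linked-snoc (v ∷ u ∷ pre) (linked-prefix cycle (subst (Linked (Adj H)) split linked)) wv
    }
    where
    cycle : List (Fin n)
    cycle = v ∷ u ∷ pre ++ [ w ]
    split : v ∷ u ∷ rest ≡ cycle ++ post
    split = cong (λ zs → v ∷ u ∷ zs) (trans rest≡ (sym (++-assoc pre [ w ] post)))

  -- Extend the simple path v ∷ u ∷ rest at v; the fuel bounds the number of
  -- extensions, as a simple path has at most n vertices.
  walk : ∀ fuel v u rest → n < length (v ∷ u ∷ rest) + fuel → Unique (v ∷ u ∷ rest) →
         Linked (Adj H) (v ∷ u ∷ rest) → All (_∉ Y) (v ∷ u ∷ rest) → Σ (Fin n) λ ℓ → deg H ℓ ≡ 1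
  walk zero v u rest long unique _ _ =
    ⊥-elim (<⇒≱ (subst (n <_) (+-identityʳ _) long) (unique-length unique))
  walk (suc fuel) v u rest long unique linked@(vu ∷ _) avoid with deg H v ≤? 1
  ... | yes deg≤1 = v , ≤-antisym deg≤1 (cnt-witness (H v) vu)
  ... | no  deg>1 = let (w , w≢u , vw) = cnt-other (H v) (≰⇒> deg>1) u in
                    extend w w≢u (trans (symmetric w v) vw) (w ∈ₗ? (v ∷ u ∷ rest))
    where
    extend : ∀ w → w ≢ u → H w v ≡ true → Dec (w ∈ₗ v ∷ u ∷ rest) → Σ (Fin n) λ ℓ → deg H ℓ ≡ 1
    extend w _   wv (yes (here refl))            = ⊥-elim (true≢false (trans (sym wv) (loopless v)))
    extend w w≢u _  (yes (there (here w≡u)))     = ⊥-elim (w≢u w≡u)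
    extend w _   wv (yes (there (there w∈rest))) = ⊥-elim (acyclic (close-cycle unique linked avoid wv w∈rest))
    extend w _   wv (no w∉path) = walk fuel w v (u ∷ rest) (subst (n <_) (+-suc _ fuel) long)
                                    (¬Any⇒All¬ _ w∉path ∷ unique) (wv ∷ linked) (avoids w v wv ∷ avoid)

  leaf : 0 < degSum H → Σ (Fin n) λ ℓ → deg H ℓ ≡ 1
  leaf nonempty with sum-positive (deg H) nonempty
  ... | x , deg>0 with cnt-positive (H x) deg>0
  ...   | y , xy = walk n y x [] (n≤1+n (suc n)) ((y≢x ∷ []) ∷ [] ∷ []) (yx ∷ [-]) (avoids y x yx ∷ avoids x y xy ∷ [])
    where
    yx : H y x ≡ true
    yx = trans (symmetric y x) xy
    y≢x : y ≢ x
    y≢x refl = true≢false (trans (sym xy) (loopless x))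

without : ∀ {n} → Graph n → (Fin n → Bool) → Graph n
without H S x y = if S x ∨ S y then false else H x y

module _ {n} (H : Graph n) (S : Fin n → Bool) where

  without-⊆ : without H S ⊆ᴳ H
  without-⊆ x y with S x | S y
  ... | false | false = λ xy → xy
  ... | false | true  = λ ()
  ... | true  | _     = λ ()

  without-symmetric : Symmetric H → Symmetric (without H S)
  without-symmetric symmetric x y rewrite ∨-comm (S x) (S y) =
    cong (if S y ∨ S x then false else_) (symmetric x y)

  without-loopless : Loopless H → Loopless (without H S)
  without-loopless loopless x with S x
  ... | true  = refl
  ... | false = loopless x

isolate : ∀ {n} → Graph n → Fin n → Graph n
isolate H ℓ = without H (single ℓ)

module _ {n} (H : Graph n) (ℓ : Fin n) where

  isolate-column : ∀ x → isolate H ℓ x ℓ ≡ false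
  isolate-column x rewrite single-self ℓ | ∨-zeroʳ (single ℓ x) = refl

  deg-isolate-self : deg (isolate H ℓ) ℓ ≡ 0
  deg-isolate-self = trans (sum-cong-≗ (λ y → cong bit (row y))) (trans (sum-const n 0) (*-zeroʳ n))
    where row : ∀ y → isolate H ℓ ℓ y ≡ false
          row y rewrite single-self ℓ = refl

  deg-isolate : ∀ x → x ≢ ℓ → deg (isolate H ℓ) x + bit (H x ℓ) ≡ deg H x
  deg-isolate x x≢ℓ = begin
    deg (isolate H ℓ) x + bit (H x ℓ)    ≡⟨ sum-update (bit ∘ isolate H ℓ x) (bit ∘ H x) ℓ agree ⟩
    deg H x + bit (isolate H ℓ x ℓ)      ≡⟨ cong (λ b → deg H x + bit b) (isolate-column x) ⟩
    deg H x + 0                          ≡⟨ +-identityʳ _ ⟩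
    deg H x                              ∎
    where
    open ≡-Reasoning
    agree : ∀ y → y ≢ ℓ → bit (isolate H ℓ x y) ≡ bit (H x y)
    agree y y≢ℓ rewrite single-other x≢ℓ | single-other y≢ℓ = refl

  module _ (symmetric : Symmetric H) (loopless : Loopless H) (leaf : deg H ℓ ≡ 1) where

    degSum-isolate : degSum H ≡ degSum (isolate H ℓ) + 2
    degSum-isolate = begin
      degSum H                                          ≡⟨ +-identityʳ _ ⟨
      degSum H + 0                                      ≡⟨ cong (degSum H +_) at-ℓ ⟨
      degSum H + (deg H′ ℓ + bit (H ℓ ℓ))               ≡⟨ sum-update (deg H) (λ x → deg H′ x + bit (H x ℓ)) ℓ off-ℓ ⟩
      sum (λ x → deg H′ x + bit (H x ℓ)) + deg H ℓ      ≡⟨ cong₂ _+_ (∑-distrib-+ (deg H′) (λ x → bit (H x ℓ))) leaf ⟩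
      degSum H′ + sum (λ x → bit (H x ℓ)) + 1           ≡⟨ cong (λ d → degSum H′ + d + 1) column ⟩
      degSum H′ + 1 + 1                                 ≡⟨ +-assoc (degSum H′) 1 1 ⟩
      degSum H′ + 2                                     ∎
      where
      open ≡-Reasoning
      H′ : Graph n
      H′ = isolate H ℓ
      at-ℓ : deg H′ ℓ + bit (H ℓ ℓ) ≡ 0
      at-ℓ rewrite deg-isolate-self | loopless ℓ = refl
      off-ℓ : ∀ x → x ≢ ℓ → deg H x ≡ deg H′ x + bit (H x ℓ)
      off-ℓ x x≢ℓ = sym (deg-isolate x x≢ℓ)
      column : sum (λ x → bit (H x ℓ)) ≡ 1
      column = trans (sum-cong-≗ (λ x → cong bit (symmetric x ℓ))) leaf

    nonIsolated-isolate : nonIsolated (isolate H ℓ) < nonIsolated H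
    nonIsolated-isolate = sum-mono-< ℓ (λ x → positive-mono (cnt-mono (without-⊆ H (single ℓ) x)))
      (subst (λ d → bit (positive d) < bit (positive (deg H ℓ))) (sym deg-isolate-self)
        (subst (λ d → 0 < bit (positive d)) (sym leaf) (s≤s z≤n)))
      where
      positive-mono : ∀ {a b} → a ≤ b → bit (positive a) ≤ bit (positive b)
      positive-mono {zero}          _ = z≤n
      positive-mono {suc _} {suc _} _ = ≤-refl

forest-degSum : ∀ {n} fuel (H : Graph n) {Y} → Symmetric H → Loopless H → EdgesAvoid Y H → Acyclic∖ H Y →
                degSum H ≤ fuel → degSum H ≤ 2 * nonIsolated H
forest-degSum zero H _ _ _ _ empty = ≤-trans empty z≤n
forest-degSum (suc fuel) H symmetric loopless avoids acyclic bounded with degSum H ≤? 0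
... | yes empty = ≤-trans empty z≤n
... | no nonempty with leaf symmetric loopless avoids acyclic (≰⇒> nonempty)
...   | ℓ , leaf-deg = begin
  degSum H                       ≡⟨ shrink ⟩
  degSum H′ + 2                  ≤⟨ +-monoˡ-≤ 2 smaller ⟩
  2 * nonIsolated H′ + 2         ≡⟨ *-distribˡ-+ 2 (nonIsolated H′) 1 ⟨
  2 * (nonIsolated H′ + 1)       ≤⟨ *-monoʳ-≤ 2 (subst (_≤ nonIsolated H) (+-comm 1 _)
                                       (nonIsolated-isolate H ℓ symmetric loopless leaf-deg)) ⟩
  2 * nonIsolated H              ∎
  where
  open ≤-Reasoning
  H′ : Graph _
  H′ = isolate H ℓ
  shrink : degSum H ≡ degSum H′ + 2
  shrink = degSum-isolate H ℓ symmetric loopless leaf-deg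
  smaller : degSum H′ ≤ 2 * nonIsolated H′
  smaller = forest-degSum fuel H′ (without-symmetric H (single ℓ) symmetric) (without-loopless H (single ℓ) loopless)
    (λ a b ab → avoids a b (without-⊆ H (single ℓ) a b ab)) (acyclic-⊆ (without-⊆ H (single ℓ)) acyclic)
    (s≤s⁻¹ (begin
      suc (degSum H′)          ≤⟨ n≤1+n _ ⟩
      2 + degSum H′            ≡⟨ +-comm 2 (degSum H′) ⟩
      degSum H′ + 2            ≡⟨ shrink ⟨
      degSum H                 ≤⟨ bounded ⟩
      suc fuel                 ∎))

-- A graph with a feedback vertex set X of size at most k has at most n + n·k
-- edges: the edges avoiding X form a forest, and the vertices of X have
-- degree at most n.
fvs-degSum : ∀ {n} k (G : Graph n) → Symmetric G → Loopless G → HasFVS k G → degSum G ≤ 2 * n + 2 * (n * k)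
fvs-degSum {n} k G symmetric loopless (X , |X|≤k , acyclic) = begin
  degSum G                                                  ≤⟨ sum-mono deg-split ⟩
  sum (λ x → deg F x + (n * bit (inX x) + cnt inX))         ≡⟨ ∑-distrib-+ (deg F) _ ⟩
  degSum F + sum (λ x → n * bit (inX x) + cnt inX)          ≡⟨ cong (degSum F +_) (∑-distrib-+ (λ x → n * bit (inX x)) _) ⟩
  degSum F + (sum (λ x → n * bit (inX x)) + sum {n} (λ _ → cnt inX))
                                                            ≡⟨ cong (degSum F +_) (cong₂ _+_ (sum-*ˡ n (bit ∘ inX)) (sum-const n _)) ⟩
  degSum F + (n * cnt inX + n * cnt inX)                    ≤⟨ +-mono-≤ forest (+-mono-≤ n|X|≤nk n|X|≤nk) ⟩
  2 * n + (n * k + n * k)                                   ≡⟨ cong (λ m → 2 * n + (n * k + m)) (+-identityʳ (n * k)) ⟨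
  2 * n + 2 * (n * k)                                       ∎
  where
  open ≤-Reasoning
  inX : Fin n → Bool
  inX = lookupᵛ X
  F : Graph n
  F = without G inX
  avoids : EdgesAvoid X F
  avoids x y xy x∈X with inX x | []=⇒lookup x∈X
  ... | true  | _ = true≢false (sym xy)
  ... | false | ()
  forest : degSum F ≤ 2 * n
  forest = ≤-trans (forest-degSum (degSum F) F (without-symmetric G inX symmetric) (without-loopless G inX loopless)
                      avoids (acyclic-⊆ (without-⊆ G inX) acyclic) ≤-refl)
                   (*-monoʳ-≤ 2 (cnt≤N (λ x → positive (deg F x))))
  n|X|≤nk : n * cnt inX ≤ n * k
  n|X|≤nk = *-monoʳ-≤ n (subst (_≤ k) (sym (cnt-lookup X)) |X|≤k)
  edge-split : ∀ x y → bit (G x y) ≤ bit (F x y) + (bit (inX x) + bit (inX y))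
  edge-split x y with inX x | inX y
  ... | true  | _     = ≤-trans (bit≤1 (G x y)) (s≤s z≤n)
  ... | false | true  = bit≤1 (G x y)
  ... | false | false = m≤m+n (bit (G x y)) 0
  deg-split : ∀ x → deg G x ≤ deg F x + (n * bit (inX x) + cnt inX)
  deg-split x = begin
    deg G x                                                         ≤⟨ sum-mono (edge-split x) ⟩
    sum (λ y → bit (F x y) + (bit (inX x) + bit (inX y)))           ≡⟨ ∑-distrib-+ (bit ∘ F x) _ ⟩
    deg F x + sum (λ y → bit (inX x) + bit (inX y))                 ≡⟨ cong (deg F x +_) (∑-distrib-+ (λ _ → bit (inX x)) (bit ∘ inX)) ⟩
    deg F x + (sum {n} (λ _ → bit (inX x)) + cnt inX)               ≡⟨ cong (λ m → deg F x + (m + cnt inX)) (sum-const n _) ⟩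
    deg F x + (n * bit (inX x) + cnt inX)                           ∎

anyList? : ∀ {n} j (P : List (Fin n) → Set) → (∀ l → Dec (P l)) → Dec (Σ (List (Fin n)) λ l → length l ≡ j × P l)
anyList? zero    P P? = map′ (λ p → [] , refl , p) (λ { ([] , _ , p) → p }) (P? [])
anyList? (suc j) P P? = map′ (λ { (x , l , len , p) → x ∷ l , cong suc len , p })
                             (λ { (x ∷ l , len , p) → x , l , suc-injective len , p })
                             (Finₚ.any? λ x → anyList? j (P ∘ (x ∷_)) (P? ∘ (x ∷_)))

module _ {n} (G : Graph n) (X : Subset n) where

  IsCycle : Fin n → List (Fin n) → Set
  IsCycle v rest = 2 ≤ length rest × Unique (v ∷ rest) × All (_∉ X) (v ∷ rest) × Linked (Adj G) (v ∷ rest ++ [ v ])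

  isCycle? : ∀ v rest → Dec (IsCycle v rest)
  isCycle? v rest = (2 ≤? length rest)
              ×-dec allPairs? (λ x y → ¬? (x ≟ y)) (v ∷ rest)
              ×-dec all? (λ x → ¬? (x ∈ˢ? X)) (v ∷ rest)
              ×-dec linked? (λ x y → G x y ≟ᵇ true) (v ∷ rest ++ [ v ])

  -- A cycle has fewer than n vertices after its start vertex.
  cycle? : Dec (CycleAvoiding G X)
  cycle? = map′ fromSearch toSearch
    (Finₚ.any? λ v → anyUpTo? (λ j → anyList? j (IsCycle v) (isCycle? v)) n)
    where
    fromSearch : (Σ (Fin n) λ v → Σ ℕ λ j → j < n × Σ (List (Fin n)) λ rest → length rest ≡ j × IsCycle v rest) → CycleAvoiding G X
    fromSearch (v , _ , _ , rest , _ , long , distinct , avoid , closed) =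
      record { v = v ; rest = rest ; long = long ; distinct = distinct ; avoid = avoid ; closed = closed }
    toSearch : CycleAvoiding G X → Σ (Fin n) λ v → Σ ℕ λ j → j < n × Σ (List (Fin n)) λ rest → length rest ≡ j × IsCycle v rest
    toSearch cycle = v , length rest , unique-length distinct , rest , refl , long , distinct , avoid , closed
      where open CycleAvoiding cycle

hasFVS? : ∀ {n} k (G : Graph n) → Dec (HasFVS k G)
hasFVS? k G = anySubset? λ X → (∣ X ∣ ≤? k) ×-dec ¬? (cycle? G X)

-- Fixed-width binary numerals (least significant bit first).

half : ℕ → ℕ
half zero          = zero
half (suc zero)    = zero
half (suc (suc x)) = suc (half x)

odd : ℕ → Bool
odd zero          = false
odd (suc zero)    = true
odd (suc (suc x)) = odd x

odd+2*half : ∀ x → bit (odd x) + 2 * half x ≡ x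
odd+2*half zero          = refl
odd+2*half (suc zero)    = refl
odd+2*half (suc (suc x)) = begin
  bit (odd x) + 2 * suc (half x)    ≡⟨ cong (bit (odd x) +_) (*-suc 2 (half x)) ⟩
  bit (odd x) + (2 + 2 * half x)    ≡⟨ +-comm (bit (odd x)) _ ⟩
  2 + 2 * half x + bit (odd x)      ≡⟨ cong (2 +_) (+-comm (2 * half x) (bit (odd x))) ⟩
  2 + (bit (odd x) + 2 * half x)    ≡⟨ cong (2 +_) (odd+2*half x) ⟩
  2 + x                             ∎
  where open ≡-Reasoning

encode : ∀ w → ℕ → Vec Bool w
encode zero    x = []
encode (suc w) x = odd x ∷ encode w (half x)

decode : ∀ {w} → Vec Bool w → ℕ
decode []      = 0
decode (b ∷ v) = bit b + 2 * decode v

decode-encode : ∀ w x → x < 2 ^ w → decode (encode w x) ≡ x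
decode-encode zero    zero    _        = refl
decode-encode zero    (suc _) (s≤s ())
decode-encode (suc w) x x<2^w = trans (cong (λ h → bit (odd x) + 2 * h) (decode-encode w (half x) half<)) (odd+2*half x)
  where
  half< : half x < 2 ^ w
  half< = *-cancelˡ-< 2 (half x) (2 ^ w)
    (≤-<-trans (m≤n+m (2 * half x) (bit (odd x))) (subst (_< 2 ^ suc w) (sym (odd+2*half x)) x<2^w))

take-++ : ∀ {A : Set} {m n} (xs : Vec A m) (ys : Vec A n) → take m (xs ++ᵛ ys) ≡ xs
take-++ {m = m} xs ys = sym (++-injectiveˡ xs _ (proj₂ (proj₂ (splitAt m (xs ++ᵛ ys)))))

drop-++ : ∀ {A : Set} {m n} (xs : Vec A m) (ys : Vec A n) → drop m (xs ++ᵛ ys) ≡ ys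
drop-++ {m = m} xs ys = sym (++-injectiveʳ xs _ (proj₂ (proj₂ (splitAt m (xs ++ᵛ ys)))))

n≤2^⌈log₂n⌉ : ∀ n → n ≤ 2 ^ ⌈log₂ n ⌉
n≤2^⌈log₂n⌉ n = bounded n n ≤-refl
  where
  bounded : ∀ fuel n → n ≤ fuel → n ≤ 2 ^ ⌈log₂ n ⌉
  bounded _          zero          _ = z≤n
  bounded _          (suc zero)    _ = s≤s z≤n
  bounded (suc fuel) (suc (suc n)) m≤fuel = begin
    m                     ≡⟨ ⌊n/2⌋+⌈n/2⌉≡n m ⟨
    ⌊ m /2⌋ + ⌈ m /2⌉     ≤⟨ +-monoˡ-≤ ⌈ m /2⌉ (⌊n/2⌋≤⌈n/2⌉ m) ⟩
    ⌈ m /2⌉ + ⌈ m /2⌉     ≤⟨ +-mono-≤ halfBound halfBound ⟩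
    2 ^ L′ + 2 ^ L′       ≡⟨ cong (2 ^ L′ +_) (+-identityʳ (2 ^ L′)) ⟨
    2 ^ suc L′            ≡⟨ cong (2 ^_) (trans (+-comm 1 L′) (m∸n+n≡m L≥1)) ⟩
    2 ^ ⌈log₂ m ⌉         ∎
    where
    open ≤-Reasoning
    m : ℕ
    m = suc (suc n)
    L′ : ℕ
    L′ = ⌈log₂ m ⌉ ∸ 1
    L≥1 : 1 ≤ ⌈log₂ m ⌉
    L≥1 = subst (_≤ ⌈log₂ m ⌉) (⌈log₂2^n⌉≡n 1) (⌈log₂⌉-mono-≤ {2} {m} (s≤s (s≤s z≤n)))
    halfBound : ⌈ m /2⌉ ≤ 2 ^ L′
    halfBound = subst (λ e → ⌈ m /2⌉ ≤ 2 ^ e) (⌈log₂⌈n/2⌉⌉≡⌈log₂n⌉∸1 m)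
                      (bounded fuel ⌈ m /2⌉ (s≤s⁻¹ (≤-trans (⌈n/2⌉<n n) m≤fuel)))

n<2^wordBits : ∀ n → n < 2 ^ wordBits n
n<2^wordBits n = ≤-<-trans (n≤2^⌈log₂n⌉ n) (m<m+n (2 ^ ⌈log₂ n ⌉) (subst (0 <_) (sym (+-identityʳ _)) (m^n>0 2 ⌈log₂ n ⌉)))

-- The adjacency vector of a graph: position combine x y holds G x y.

adjacency : ∀ {n} → Graph n → Fin (n * n) → Bool
adjacency {n} G i = G (proj₁ (remQuot {n} n i)) (proj₂ (remQuot {n} n i))

adjacency-combine : ∀ {n} (G : Graph n) x y → adjacency G (combine x y) ≡ G x y
adjacency-combine {n} G x y = cong (λ (x , y) → G x y) (Finₚ.remQuot-combine {n} {n} x y)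

sum-++ : ∀ a b (f : Fin (a + b) → ℕ) → sum f ≡ sum (λ i → f (i ↑ˡ b)) + sum (λ i → f (a ↑ʳ i))
sum-++ zero    b f = refl
sum-++ (suc a) b f = trans (cong (f zero +_) (sum-++ a b (f ∘ suc))) (sym (+-assoc (f zero) _ _))

sum-combine : ∀ m n (f : Fin (m * n) → ℕ) → sum f ≡ sum {m} (λ x → sum {n} (λ y → f (combine x y)))
sum-combine zero    n f = refl
sum-combine (suc m) n f = trans (sum-++ n (m * n) f) (cong (sum (λ y → f (y ↑ˡ (m * n))) +_) (sum-combine m n (f ∘ (n ↑ʳ_))))

cnt-adjacency : ∀ {n} (G : Graph n) → cnt (adjacency G) ≡ degSum G
cnt-adjacency {n} G = trans (sum-combine n n (bit ∘ adjacency G))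
                            (sum-cong-≗ λ x → sum-cong-≗ λ y → cong bit (adjacency-combine G x y))

combine-swap : ∀ {n} {u v : Fin n} → u ≢ v → combine u v ≢ combine v u
combine-swap {u = u} {v} u≢v same = u≢v (Finₚ.combine-injectiveˡ u v v u same)

module _ {n} (G : Graph n) (b : Bool) (u v : Fin n) where

  private
    G′ : Graph n
    G′ = applyUpd G (b , u , v)
    f : Fin (n * n) → Bool
    f = adjacency G
    p q : Fin (n * n)
    p = combine u v
    q = combine v u
    open ≡-Reasoning

    both-false : ∀ {x y x′ y′ : Fin n} → ¬ (x ≡ x′ × y ≡ y′) → single x′ x ∧ single y′ y ≡ false
    both-false {x} {y} {x′} {y′} ¬both with x ≟ x′ | y ≟ y′
    ... | yes x≡ | yes y≡ = ⊥-elim (¬both (x≡ , y≡))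
    ... | yes _  | no _   = refl
    ... | no _   | _      = refl

  update-uv : G′ u v ≡ b
  update-uv rewrite single-self u | single-self v = refl

  update-vu : G′ v u ≡ b
  update-vu rewrite single-self u | single-self v | ∨-zeroʳ (single u v ∧ single v u) = refl

  update-off : ∀ x y → ¬ (x ≡ u × y ≡ v) → ¬ (x ≡ v × y ≡ u) → G′ x y ≡ G x y
  update-off x y ¬uv ¬vu rewrite both-false ¬uv | both-false ¬vu = refl

  update-symmetric : Symmetric G → Symmetric G′
  update-symmetric symmetric x y
    rewrite ∧-comm (single u x) (single v y) | ∧-comm (single v x) (single u y)
          | ∨-comm (single v y ∧ single u x) (single u y ∧ single v x) | symmetric x y = refl

  update-loopless : u ≢ v → Loopless G → Loopless G′
  update-loopless u≢v loopless x
    rewrite both-false {x} {x} (λ (x≡u , x≡v) → u≢v (trans (sym x≡u) x≡v))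
          | both-false {x} {x} (λ (x≡v , x≡u) → u≢v (trans (sym x≡u) x≡v)) = loopless x

  adjacency-update : Symmetric G → u ≢ v → G u v ≡ not b →
                     ∀ i → adjacency G′ i ≡ toggle (combine v u) (toggle (combine u v) (adjacency G)) i
  adjacency-update symmetric u≢v absent i = by-position (i ≟ p) (i ≟ q)
    where
    by-position : Dec (i ≡ p) → Dec (i ≡ q) → adjacency G′ i ≡ toggle q (toggle p f) i
    by-position (yes refl) _ = begin
      adjacency G′ p                 ≡⟨ trans (adjacency-combine G′ u v) update-uv ⟩
      b                              ≡⟨ trans (sym (not-involutive b)) (cong not (sym absent)) ⟩
      not (G u v)                    ≡⟨ cong not (adjacency-combine G u v) ⟨
      not (f p)                      ≡⟨ toggle-self p f ⟨
      toggle p f p                   ≡⟨ toggle-other (toggle p f) (combine-swap u≢v) ⟨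
      toggle q (toggle p f) p        ∎
    by-position (no q≢p) (yes refl) = begin
      adjacency G′ q                 ≡⟨ trans (adjacency-combine G′ v u) update-vu ⟩
      b                              ≡⟨ trans (sym (not-involutive b)) (cong not (sym absent)) ⟩
      not (G u v)                    ≡⟨ cong not (trans (symmetric u v) (sym (adjacency-combine G v u))) ⟩
      not (f q)                      ≡⟨ cong not (toggle-other f q≢p) ⟨
      not (toggle p f q)             ≡⟨ toggle-self q (toggle p f) ⟨
      toggle q (toggle p f) q        ∎
    by-position (no i≢p) (no i≢q) = begin
      adjacency G′ i                 ≡⟨ update-off x y (apart i≢p) (apart i≢q) ⟩
      f i                            ≡⟨ toggle-other f i≢p ⟨
      toggle p f i                   ≡⟨ toggle-other (toggle p f) i≢q ⟨
      toggle q (toggle p f) i        ∎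
      where
      x y : Fin n
      x = proj₁ (remQuot {n} n i)
      y = proj₂ (remQuot {n} n i)
      apart : ∀ {x′ y′} → i ≢ combine x′ y′ → ¬ (x ≡ x′ × y ≡ y′)
      apart i≢ (x≡ , y≡) = i≢ (trans (sym (Finₚ.combine-remQuot {n} n i)) (cong₂ combine x≡ y≡))

shift : Bool → ℕ → ℕ
shift true  c = c + 2
shift false c = c ∸ 2

cnt-toggle₂ : ∀ {N} {p q : Fin N} (f : Fin N → Bool) b → p ≢ q → f p ≡ not b → f q ≡ not b →
              cnt (toggle q (toggle p f)) ≡ shift b (cnt f)
cnt-toggle₂ {p = p} {q} f true p≢q fp fq = begin
  cnt (toggle q (toggle p f))   ≡⟨ cnt-raise (toggle p f) (trans (toggle-other f (p≢q ∘ sym)) fq) ⟩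
  cnt (toggle p f) + 1          ≡⟨ cong (_+ 1) (cnt-raise f fp) ⟩
  cnt f + 1 + 1                 ≡⟨ +-assoc (cnt f) 1 1 ⟩
  cnt f + 2                     ∎
  where open ≡-Reasoning
cnt-toggle₂ {p = p} {q} f false p≢q fp fq = begin
  cnt (toggle q (toggle p f))             ≡⟨ m+n∸n≡m _ 2 ⟨
  cnt (toggle q (toggle p f)) + 2 ∸ 2     ≡⟨ cong (_∸ 2) (+-assoc (cnt (toggle q (toggle p f))) 1 1) ⟨
  cnt (toggle q (toggle p f)) + 1 + 1 ∸ 2 ≡⟨ cong (λ m → m + 1 ∸ 2) (cnt-drop (toggle p f) (trans (toggle-other f (p≢q ∘ sym)) fq)) ⟩
  cnt (toggle p f) + 1 ∸ 2                ≡⟨ cong (_∸ 2) (cnt-drop f fp) ⟩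
  cnt f ∸ 2                               ∎
  where open ≡-Reasoning

isYes⇔ : ∀ {P : Set} (d : Dec P) → (⌊ d ⌋ ≡ true) ⇔ P
isYes⇔ (yes p) = mk⇔ (λ _ → p) (λ _ → refl)
isYes⇔ (no ¬p) = mk⇔ (λ ()) (λ p → ⊥-elim (¬p p))

hasFVS-≗ : ∀ {n} k {G H : Graph n} → (∀ x y → G x y ≡ H x y) → HasFVS k G → HasFVS k H
hasFVS-≗ k G≗H (X , |X|≤k , acyclic) = X , |X|≤k , acyclic-⊆ (λ x y Hxy → trans (G≗H x y) Hxy) acyclic

module Algorithm (n k : ℕ) where

  N w c B t s : ℕ
  N = n * n
  w = wordBits n
  c = 2 * w                      -- bits of the edge counter
  B = 2 * n + 2 * (n * k)        -- degree sum of any yes-instance (fvs-degSum)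
  t = suc (c * (B + B))          -- bits of the syndrome
  s = c + t

  N<2^c : N < 2 ^ c
  N<2^c = subst (N <_) (trans (sym (^-distribˡ-+-* 2 w w)) (cong (λ e → 2 ^ (w + e)) (sym (+-identityʳ w))))
                (*-mono-< (n<2^wordBits n) (n<2^wordBits n))

  -- N^(2B) ≤ 2^(c·2B) < 2^t leaves room for a (B + B)-independent code.
  few-sparse : N ^ (B + B) < 2 ^ t
  few-sparse = ≤-<-trans (^-monoˡ-≤ (B + B) (<⇒≤ N<2^c))
    (subst (_< 2 ^ t) (sym (^-*-assoc 2 c (B + B)))
      (m<m+n (2 ^ (c * (B + B))) (subst (0 <_) (sym (+-identityʳ _)) (m^n>0 2 (c * (B + B))))))

  code : Fin N → Subset t
  code = proj₁ (independent-code (B + B) N few-sparse)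

  independent : Independent (B + B) code
  independent = proj₂ (independent-code (B + B) N few-sparse)

  counter-fits : ∀ (f : Fin N → Bool) → cnt f < 2 ^ c
  counter-fits f = ≤-<-trans (cnt≤N f) N<2^c

  sketch : Graph n → Vec Bool s
  sketch G = encode c (cnt (adjacency G)) ++ᵛ syn code (adjacency G)

  step : Vec Bool s → Update n → Vec Bool s
  step st (b , u , v) = encode c (shift b (decode (take c st))) ++ᵛ (drop c st ⊕ code (combine u v) ⊕ code (combine v u))

  -- Accept iff some adjacency vector with the stored counter (at most B) and
  -- syndrome is a yes-instance; such a vector is unique.
  toGraph : (Fin N → Bool) → Graph n
  toGraph S x y = S (combine x y)

  Accepts : ℕ → Subset t → Set
  Accepts count σ = count ≤ B × Σ (Subset N) λ S →
    cnt (lookupᵛ S) ≡ count × syn code (lookupᵛ S) ≡ σ × HasFVS k (toGraph (lookupᵛ S))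

  accepts? : ∀ count σ → Dec (Accepts count σ)
  accepts? count σ = (count ≤? B) ×-dec anySubset? λ S →
    (cnt (lookupᵛ S) ≟ℕ count) ×-dec ≡-dec _≟ᵇ_ (syn code (lookupᵛ S)) σ ×-dec hasFVS? k (toGraph (lookupᵛ S))

  out : Vec Bool s → Bool
  out st = ⌊ accepts? (decode (take c st)) (drop c st) ⌋

  algorithm : StreamAlg (Update n) s
  algorithm = record { init = sketch emptyGraph ; step = step ; out = out }

  take-sketch : ∀ G → decode (take c (sketch G)) ≡ cnt (adjacency G)
  take-sketch G = trans (cong decode (take-++ (encode c (cnt (adjacency G))) (syn code (adjacency G)))) (decode-encode c _ (counter-fits (adjacency G)))

  drop-sketch : ∀ G → drop c (sketch G) ≡ syn code (adjacency G)
  drop-sketch G = drop-++ (encode c (cnt (adjacency G))) _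

  step-sketch : ∀ G b u v → Symmetric G → u ≢ v → G u v ≡ not b → step (sketch G) (b , u , v) ≡ sketch (applyUpd G (b , u , v))
  step-sketch G b u v symmetric u≢v absent = begin
    step (sketch G) (b , u , v)
      ≡⟨ cong₂ (λ m σ → encode c (shift b m) ++ᵛ (σ ⊕ code p ⊕ code q)) (take-sketch G) (drop-sketch G) ⟩
    encode c (shift b (cnt f)) ++ᵛ (syn code f ⊕ code p ⊕ code q)
      ≡⟨ cong₂ (λ m σ → encode c m ++ᵛ σ) counter syndrome ⟩
    sketch (applyUpd G (b , u , v)) ∎
    where
    open ≡-Reasoning
    f g : Fin N → Bool
    f = adjacency G
    g = adjacency (applyUpd G (b , u , v))
    p q : Fin N
    p = combine u v
    q = combine v u
    toggled : ∀ i → g i ≡ toggle q (toggle p f) i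
    toggled = adjacency-update G b u v symmetric u≢v absent
    counter : shift b (cnt f) ≡ cnt g
    counter = trans (sym (cnt-toggle₂ f b (combine-swap u≢v)
                          (trans (adjacency-combine G u v) absent)
                          (trans (adjacency-combine G v u) (trans (symmetric v u) absent))))
                    (sum-cong-≗ (λ i → cong bit (sym (toggled i))))
    syndrome : syn code f ⊕ code p ⊕ code q ≡ syn code g
    syndrome = begin
      syn code f ⊕ code p ⊕ code q           ≡⟨ cong (_⊕ code q) (syn-toggle code p f) ⟨
      syn code (toggle p f) ⊕ code q         ≡⟨ syn-toggle code q (toggle p f) ⟨
      syn code (toggle q (toggle p f))       ≡⟨ syn-cong code (sym ∘ toggled) ⟩
      syn code g                             ∎

  run-sketch : ∀ G str → Symmetric G → Loopless G → ValidFrom G str →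
               foldl step (sketch G) str ≡ sketch (graphAfter G str) ×
               Symmetric (graphAfter G str) × Loopless (graphAfter G str)
  run-sketch G []                  symmetric loopless _ = refl , symmetric , loopless
  run-sketch G ((b , u , v) ∷ str) symmetric loopless (u≢v , absent , valid) =
    let (run , simple) = run-sketch (applyUpd G (b , u , v)) str (update-symmetric G b u v symmetric)
                                    (update-loopless G b u v u≢v loopless) valid
    in trans (cong (λ st → foldl step st str) (step-sketch G b u v symmetric u≢v absent)) run , simple

  -- For a simple graph with adjacency vector f, acceptance of (cnt f , syn f)
  -- is equivalent to having a small FVS: the witness S must be f itself.
  accepts-sketch : ∀ G → Symmetric G → Loopless G → Accepts (cnt (adjacency G)) (syn code (adjacency G)) ⇔ HasFVS k G
  accepts-sketch G symmetric loopless = mk⇔ to from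
    where
    f : Fin N → Bool
    f = adjacency G
    toGraph-f : ∀ x y → toGraph f x y ≡ G x y
    toGraph-f = adjacency-combine G
    to : Accepts (cnt f) (syn code f) → HasFVS k G
    to (cnt≤B , S , cntS , synS , fvs) = hasFVS-≗ k (λ x y → trans (S≗f (combine x y)) (toGraph-f x y)) fvs
      where
      S≗f : ∀ i → lookupᵛ S i ≡ f i
      S≗f = syn-injective independent (lookupᵛ S) f (subst (_≤ B) (sym cntS) cnt≤B) cnt≤B synS
    from : HasFVS k G → Accepts (cnt f) (syn code f)
    from fvs = subst (_≤ B) (sym (cnt-adjacency G)) (fvs-degSum k G symmetric loopless fvs)
             , tabulate f
             , sum-cong-≗ (cong bit ∘ lookup∘tabulate f)
             , syn-cong code (lookup∘tabulate f)
             , hasFVS-≗ k (λ x y → sym (trans (lookup∘tabulate f (combine x y)) (toGraph-f x y))) fvs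

  out-sketch : ∀ G → Symmetric G → Loopless G → (out (sketch G) ≡ true) ⇔ HasFVS k G
  out-sketch G symmetric loopless = mk⇔ (to accepts ∘ to decided ∘ subst (_≡ true) read)
                                        (subst (_≡ true) (sym read) ∘ from decided ∘ from accepts)
    where
    open Equivalence
    f : Fin N → Bool
    f = adjacency G
    read : out (sketch G) ≡ ⌊ accepts? (cnt f) (syn code f) ⌋
    read = cong₂ (λ m σ → ⌊ accepts? m σ ⌋) (take-sketch G) (drop-sketch G)
    decided : (⌊ accepts? (cnt f) (syn code f) ⌋ ≡ true) ⇔ Accepts (cnt f) (syn code f)
    decided = isYes⇔ (accepts? (cnt f) (syn code f))
    accepts : Accepts (cnt f) (syn code f) ⇔ HasFVS k G
    accepts = accepts-sketch G symmetric loopless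

  correct : Solves AnyStream k algorithm
  correct str valid _ =
    let (run , symmetric , loopless) = run-sketch emptyGraph str (λ _ _ → refl) (λ _ → refl) valid
    in subst (λ st → (out st ≡ true) ⇔ HasFVS k (graphOf str)) (sym run) (out-sketch (graphOf str) symmetric loopless)

-- Space: with P = (k ⊔ 1)·n ≥ 1 we have B ≤ 4P, so s = 2w + 1 + 2w·2B ≤ 19·P·w.
space : ∀ n k → 1 ≤ n → Algorithm.s n k ≤ 19 * kn k n * wordBits n
space n k 1≤n = begin
  2 * w + suc (2 * w * (B + B))          ≤⟨ +-monoʳ-≤ (2 * w) (s≤s (*-monoʳ-≤ (2 * w) (+-mono-≤ B≤4P B≤4P))) ⟩
  2 * w + suc (2 * w * (4 * P + 4 * P))  ≡⟨ expand P w ⟩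
  2 * w + 1 + 16 * (P * w)               ≤⟨ +-monoˡ-≤ (16 * (P * w)) (+-mono-≤ (*-monoʳ-≤ 2 w≤Pw) 1≤Pw) ⟩
  2 * (P * w) + P * w + 16 * (P * w)     ≡⟨ collect P w ⟩
  19 * P * w                             ∎
  where
  open ≤-Reasoning
  open Algorithm n k using (B; w)
  P : ℕ
  P = kn k n
  expand : ∀ P w → 2 * w + suc (2 * w * (4 * P + 4 * P)) ≡ 2 * w + 1 + 16 * (P * w)
  expand = solve-∀
  collect : ∀ P w → 2 * (P * w) + P * w + 16 * (P * w) ≡ 19 * P * w
  collect = solve-∀
  1≤K : 1 ≤ k ⊔ 1
  1≤K = m≤n⊔m k 1
  n≤P : n ≤ P
  n≤P = subst (_≤ P) (*-identityˡ n) (*-monoˡ-≤ n 1≤K)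
  nk≤P : n * k ≤ P
  nk≤P = subst (_≤ P) (*-comm k n) (*-monoˡ-≤ n (m≤m⊔n k 1))
  B≤4P : B ≤ 4 * P
  B≤4P = ≤-trans (+-mono-≤ (*-monoʳ-≤ 2 n≤P) (*-monoʳ-≤ 2 nk≤P)) (≤-reflexive (four P))
    where four : ∀ P → 2 * P + 2 * P ≡ 4 * P
          four = solve-∀
  1≤Pw : 1 ≤ P * w
  1≤Pw = *-mono-≤ (*-mono-≤ 1≤K 1≤n) (s≤s z≤n)
  w≤Pw : w ≤ P * w
  w≤Pw = subst (_≤ P * w) (*-identityˡ w) (*-monoˡ-≤ w (*-mono-≤ 1≤K 1≤n))

streaming-FVS : (n k : ℕ) → Σ ℕ λ s → s ≤ 19 * kn k n * wordBits n × Σ (StreamAlg (Update n) s) λ A → Solves AnyStream k A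
streaming-FVS zero    k = 0 , z≤n , trivial , λ _ _ _ → mk⇔ (λ _ → [] , z≤n , noVertex) (λ _ → refl)
  where
  -- Without vertices every graph is a forest.
  trivial : StreamAlg (Update zero) 0
  trivial = record { init = [] ; step = λ st _ → st ; out = λ _ → true }
  noVertex : ∀ {G} → Acyclic∖ G []
  noVertex cycle with CycleAvoiding.v cycle
  ... | ()
streaming-FVS (suc n) k = Algorithm.s (suc n) k , space (suc n) k (s≤s z≤n) , Algorithm.algorithm (suc n) k , Algorithm.correct (suc n) k

theorem27 : (Σ ℕ λ C → (n k : ℕ) → Σ ℕ λ s → s ≤ C * kn k n * wordBits n × Σ (StreamAlg (Update n) s) λ A → Solves InsertionOnly k A)
          × (Σ ℕ λ C → Σ ℕ λ c → (n k : ℕ) → Σ ℕ λ s → s ≤ C * kn k n * wordBits n ^ c * wordBits n × Σ (StreamAlg (Update n) s) λ A → Solves AnyStream k A)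
theorem27 = (19 , insertionOnly) , (19 , 0 , anyStream)
  where
  -- Insertion-only streams are a special case; the polylog exponent is 0.
  insertionOnly : (n k : ℕ) → Σ ℕ λ s → s ≤ 19 * kn k n * wordBits n × Σ (StreamAlg (Update n) s) λ A → Solves InsertionOnly k A
  insertionOnly n k = let (s , s≤ , A , solves) = streaming-FVS n k in s , s≤ , A , λ str valid _ → solves str valid tt
  anyStream : (n k : ℕ) → Σ ℕ λ s → s ≤ 19 * kn k n * wordBits n ^ 0 * wordBits n × Σ (StreamAlg (Update n) s) λ A → Solves AnyStream k A
  anyStream n k = let (s , s≤ , A , solves) = streaming-FVS n k in
    s , subst (λ C → s ≤ C * wordBits n) (sym (*-identityʳ (19 * kn k n))) s≤ , A , solves
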